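{- Let $2 \leq \ell \leq k \leq \frac{q^n-1}{q-1}$ with $\ell \leq n$. Then $\operatorname{Ind}_q^{{\rm pro}}(n,k,\ell) \leq \operatorname{Ind}_q(n,k,\ell)$. Moreover $\operatorname{Ind}_q^{\operatorname{pro}}(n,\ell,\ell)=\operatorname{Ind}_q(n,\ell,\ell)$.
   Context: For $1\le\ell\le k\le q^n-1$ with $\ell\le n$, $S\subseteq\mathbb{F}_q^n\setminus\{\mathbf 0\}$ is $(k,\ell)$-independent if every subset of $S$ of size $k$ contains $\ell$ linearly independent vectors, and $\operatorname{Ind}_q(n,k,\ell)$ is the maximum size of such $S$. For $1\le\ell\le k\le\frac{q^n-1}{q-1}$ with $\ell\le n$, $S\subseteq\mathbb{P}^{n-1}(\mathbb{F}_q)$ is $(k,\ell)$-pro-independent if every $X\subseteq S$ of size $k$ contains $\ell$ linearly independent points, and $\operatorname{Ind}^{\rm pro}_q(n,k,\ell)$ is the maximum size of such $S$. -}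

module Defs where

open import Level using (0ℓ)
open import Algebra.Bundles using (CommutativeRing)
open import Data.Nat using (ℕ; _≤_)
open import Data.Fin using (Fin; zero; suc)
open import Data.List using (List; []; _∷_; length)
open import Data.List.Relation.Unary.All using (All)
open import Data.List.Relation.Unary.AllPairs using (AllPairs)
open import Data.List.Relation.Binary.Sublist.Propositional using (_⊆_)
open import Data.Product using (Σ; ∃; _×_)
open import Relation.Nullary using (¬_)
open import Relation.Binary.PropositionalEquality using (_≡_)
open import Function using (_∘_)

record FiniteField (q : ℕ) : Set₁ where
  field
    commRing : CommutativeRing 0ℓ 0ℓ
  open CommutativeRing commRing public hiding (ring)
  field
    1≉0             : ¬ (1# ≈ 0#)
    inverse         : ∀ x → ¬ (x ≈ 0#) → ∃ λ y → x * y ≈ 1#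
    enum            : Fin q → Carrier
    enum-injective  : ∀ i j → enum i ≈ enum j → i ≡ j
    enum-surjective : ∀ x → ∃ λ i → enum i ≈ x

module _ {q : ℕ} (F : FiniteField q) where
  open FiniteField F using (Carrier; _≈_; _+_; _*_; 0#)

  Vect : ℕ → Set
  Vect n = Fin n → Carrier

  _≈ᵥ_ : ∀ {n} → Vect n → Vect n → Set
  u ≈ᵥ v = ∀ i → u i ≈ v i

  0ᵥ : ∀ {n} → Vect n
  0ᵥ _ = 0#

  NonZeroV : ∀ {n} → Vect n → Set
  NonZeroV v = ¬ (v ≈ᵥ 0ᵥ)

  lincomb : ∀ {n} (vs : List (Vect n)) → (Fin (length vs) → Carrier) → Vect n
  lincomb []       c = 0ᵥ
  lincomb (v ∷ vs) c = λ i → (c zero * v i) + lincomb vs (c ∘ suc) i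

  LinIndep : ∀ {n} → List (Vect n) → Set
  LinIndep vs = ∀ c → lincomb vs c ≈ᵥ 0ᵥ → ∀ i → c i ≈ 0#

  ContainsIndep : ∀ {n} → ℕ → List (Vect n) → Set
  ContainsIndep ℓ X = Σ (List _) λ Y → Y ⊆ X × length Y ≡ ℓ × LinIndep Y

  -- every k-element subset of S contains ℓ linearly independent elements
  -- (subsets of a duplicate-free list = its sublists)
  KLProperty : ∀ {n} → ℕ → ℕ → List (Vect n) → Set
  KLProperty k ℓ S = ∀ X → X ⊆ S → length X ≡ k → ContainsIndep ℓ X

  -- a finite set S ⊆ F_q^n \ {0}, as a duplicate-free list of nonzero vectors
  IsVecSet : ∀ {n} → List (Vect n) → Set
  IsVecSet S = All NonZeroV S × AllPairs (λ u v → ¬ (u ≈ᵥ v)) S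

  Proportional : ∀ {n} → Vect n → Vect n → Set
  Proportional u v = ∃ λ a → ¬ (a ≈ 0#) × (∀ i → u i ≈ a * v i)

  -- a finite set of points of P^{n-1}(F_q), each given by a representative
  -- nonzero vector, no two representing the same point
  IsProjSet : ∀ {n} → List (Vect n) → Set
  IsProjSet S = All NonZeroV S × AllPairs (λ u v → ¬ Proportional u v) S

  KLIndependent : (n k ℓ : ℕ) → List (Vect n) → Set
  KLIndependent n k ℓ S = IsVecSet S × KLProperty k ℓ S

  KLProIndependent : (n k ℓ : ℕ) → List (Vect n) → Set
  KLProIndependent n k ℓ S = IsProjSet S × KLProperty k ℓ S

  IsInd : (n k ℓ m : ℕ) → Set
  IsInd n k ℓ m =
    (Σ (List (Vect n)) λ S → KLIndependent n k ℓ S × length S ≡ m) ×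
    (∀ S → KLIndependent n k ℓ S → length S ≤ m)

  IsIndPro : (n k ℓ m : ℕ) → Set
  IsIndPro n k ℓ m =
    (Σ (List (Vect n)) λ S → KLProIndependent n k ℓ S × length S ≡ m) ×
    (∀ S → KLProIndependent n k ℓ S → length S ≤ m)

{-# OPTIONS --safe #-}
-- A projective set is given by pairwise non-proportional nonzero representatives, which are in
-- particular distinct, so every (k,ℓ)-pro-independent set is (k,ℓ)-independent.  Conversely, let
-- k = ℓ ≥ 2 and S be (ℓ,ℓ)-independent.  If |S| ≥ ℓ, any two vectors of S lie in an ℓ-subset, which
-- must be linearly independent, so no two vectors of S are proportional and S is itself
-- pro-independent.  If |S| < ℓ ≤ n, then |S| distinct unit vectors form a (vacuously)
-- pro-independent set of the same size.
module Submission where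

open import Defs
open import Data.Nat using (ℕ; suc; _≤_; _<_; s≤s; _*_; _∸_; _^_; _⊓_)
open import Data.Nat.Properties
  using (≤-trans; ≤-antisym; <⇒≤; ≤-<-trans; <-irrefl; m≤n⇒m<n∨m≡n; m≤n⇒m⊓n≡m; n≤0⇒n≡0; _≤?_; ≰⇒>)
open import Data.Fin using (Fin; zero; suc; _≟_)
open import Data.List using (List; []; _∷_; length; map; take; allFin)
open import Data.List.Properties using (length-map; length-take; length-tabulate)
import Data.List.Relation.Unary.All as All
import Data.List.Relation.Unary.All.Properties as Allₚ
open import Data.List.Relation.Unary.AllPairs as AllPairs using (AllPairs; []; _∷_)
import Data.List.Relation.Unary.AllPairs.Properties as AllPairsₚ
open import Data.List.Relation.Unary.Unique.Propositional.Properties using (allFin⁺)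
open import Data.List.Relation.Binary.Equality.Propositional using (≋⇒≡)
open import Data.List.Relation.Binary.Sublist.Propositional
  using (_⊆_; []; _∷_; _∷ʳ_; ⊆-refl; from∈)
open import Data.List.Relation.Binary.Sublist.Propositional.Properties using (length-mono-≤; to-≋)
open import Data.Product using (_×_; _,_; ∃-syntax)
open import Data.Sum using (inj₁; inj₂)
open import Function using (id; _∘_)
open import Relation.Nullary using (¬_; yes; no; contradiction)
open import Relation.Binary.PropositionalEquality using (_≡_; refl; sym; trans; cong; subst)
open import Algebra.Bundles using (CommutativeRing)
import Algebra.Properties.Ring as RingProperties

module _ {a} {A : Set a} where

  ⊆-intermediate : ∀ {ys zs : List A} (m : ℕ) → length ys ≤ m → m ≤ length zs → ys ⊆ zs →
                   ∃[ xs ] ys ⊆ xs × xs ⊆ zs × length xs ≡ m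
  ⊆-intermediate m _ m≤0 [] = [] , [] , [] , sym (n≤0⇒n≡0 m≤0)
  ⊆-intermediate m ys≤m m≤z∷zs (z ∷ʳ τ) with m≤n⇒m<n∨m≡n m≤z∷zs
  ... | inj₂ refl = _ , z ∷ʳ τ , ⊆-refl , refl
  ... | inj₁ (s≤s m≤zs) with ⊆-intermediate m ys≤m m≤zs τ
  ...   | xs , ys⊆xs , xs⊆zs , refl = xs , ys⊆xs , z ∷ʳ xs⊆zs , refl
  ⊆-intermediate (suc m) (s≤s ys≤m) (s≤s m≤zs) (refl ∷ τ) with ⊆-intermediate m ys≤m m≤zs τ
  ... | xs , ys⊆xs , xs⊆zs , refl = _ , refl ∷ ys⊆xs , refl ∷ xs⊆zs , refl

  ⊆-length-≡⇒≡ : ∀ {xs ys : List A} → xs ⊆ ys → length xs ≡ length ys → xs ≡ ys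
  ⊆-length-≡⇒≡ τ eq = ≋⇒≡ (to-≋ eq τ)

  AllPairs-fromPairSublists : ∀ {r} {R : A → A → Set r} {xs : List A} →
                              (∀ {x y} → x ∷ y ∷ [] ⊆ xs → R x y) → AllPairs R xs
  AllPairs-fromPairSublists {xs = []}     _ = []
  AllPairs-fromPairSublists {xs = x ∷ xs} R-pairs =
    All.tabulate (λ y∈xs → R-pairs (refl ∷ from∈ y∈xs)) ∷ AllPairs-fromPairSublists (R-pairs ∘ (x ∷ʳ_))

module _ {q : ℕ} (F : FiniteField q) where
  open FiniteField F
    renaming (refl to ≈-refl; sym to ≈-sym; trans to ≈-trans; _*_ to _·_) hiding (zero)
  open RingProperties (CommutativeRing.ring commRing) using (-‿distribˡ-*)
  open import Relation.Binary.Reasoning.Setoid setoid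

  private
    variable
      n k ℓ : ℕ

  padCoeffs : ∀ {ys xs : List (Vect F n)} → ys ⊆ xs →
              (Fin (length ys) → Carrier) → Fin (length xs) → Carrier
  padCoeffs (_ ∷ʳ τ) c zero    = 0#
  padCoeffs (_ ∷ʳ τ) c (suc i) = padCoeffs τ c i
  padCoeffs (refl ∷ τ) c zero    = c zero
  padCoeffs (refl ∷ τ) c (suc i) = padCoeffs τ (c ∘ suc) i

  lincomb-padCoeffs : ∀ {ys xs : List (Vect F n)} (τ : ys ⊆ xs) c →
                      _≈ᵥ_ F (lincomb F xs (padCoeffs τ c)) (lincomb F ys c)
  lincomb-padCoeffs [] c i = ≈-refl
  lincomb-padCoeffs {ys = ys} {x ∷ xs} (_ ∷ʳ τ) c i = begin
    0# · x i + lincomb F xs (padCoeffs τ c) i ≈⟨ +-cong (zeroˡ (x i)) (lincomb-padCoeffs τ c i) ⟩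
    0# + lincomb F ys c i                      ≈⟨ +-identityˡ _ ⟩
    lincomb F ys c i                           ∎
  lincomb-padCoeffs (refl ∷ τ) c i = +-cong ≈-refl (lincomb-padCoeffs τ (c ∘ suc) i)

  padCoeffs-covers : ∀ {ys xs : List (Vect F n)} (τ : ys ⊆ xs) c j → ∃[ i ] padCoeffs τ c i ≡ c j
  padCoeffs-covers (_ ∷ʳ τ) c j = let i , eq = padCoeffs-covers τ c j in suc i , eq
  padCoeffs-covers (refl ∷ τ) c zero    = zero , refl
  padCoeffs-covers (refl ∷ τ) c (suc j) = let i , eq = padCoeffs-covers τ (c ∘ suc) j in suc i , eq

  LinIndep-⊆ : ∀ {ys xs : List (Vect F n)} → ys ⊆ xs → LinIndep F xs → LinIndep F ys
  LinIndep-⊆ τ xs-indep c ys-dep j =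
    let i , eq = padCoeffs-covers τ c j
    in subst (_≈ 0#) eq (xs-indep (padCoeffs τ c) (λ t → ≈-trans (lincomb-padCoeffs τ c t) (ys-dep t)) i)

  ContainsIndep-length⇒LinIndep : ∀ {xs : List (Vect F n)} →
                                  ContainsIndep F ℓ xs → length xs ≡ ℓ → LinIndep F xs
  ContainsIndep-length⇒LinIndep (ys , ys⊆xs , refl , ys-indep) eq =
    subst (LinIndep F) (⊆-length-≡⇒≡ ys⊆xs (sym eq)) ys-indep

  ≈ᵥ⇒Proportional : ∀ {u v : Vect F n} → _≈ᵥ_ F u v → Proportional F u v
  ≈ᵥ⇒Proportional {v = v} u≈v = 1# , 1≉0 , λ i → ≈-trans (u≈v i) (≈-sym (*-identityˡ (v i)))

  LinIndep-pair⇒¬Proportional : ∀ {u v : Vect F n} → LinIndep F (u ∷ v ∷ []) → ¬ Proportional F u v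
  LinIndep-pair⇒¬Proportional {u = u} {v} indep (a , _ , u≈av) = 1≉0 (indep c dependence zero)
    where
    c : Fin 2 → Carrier
    c zero    = 1#
    c (suc _) = - a
    dependence : _≈ᵥ_ F (lincomb F (u ∷ v ∷ []) c) (0ᵥ F)
    dependence i = begin
      1# · u i + (- a · v i + 0#) ≈⟨ +-cong (*-identityˡ _) (+-identityʳ _) ⟩
      u i + - a · v i             ≈⟨ +-cong (u≈av i) (≈-sym (-‿distribˡ-* a (v i))) ⟩
      a · v i + - (a · v i)       ≈⟨ -‿inverseʳ _ ⟩
      0#                          ∎

  IsProjSet⇒IsVecSet : ∀ {S : List (Vect F n)} → IsProjSet F S → IsVecSet F S
  IsProjSet⇒IsVecSet (nonzero , nonProportional) =
    nonzero , AllPairs.map (_∘ ≈ᵥ⇒Proportional) nonProportional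

  KLProIndependent⇒KLIndependent : ∀ {S} → KLProIndependent F n k ℓ S → KLIndependent F n k ℓ S
  KLProIndependent⇒KLIndependent (proj , kl) = IsProjSet⇒IsVecSet proj , kl

  KLProperty⇒pairwise-¬Proportional : ∀ {S : List (Vect F n)} → 2 ≤ ℓ → ℓ ≤ length S →
                                      KLProperty F ℓ ℓ S → AllPairs (λ u v → ¬ Proportional F u v) S
  KLProperty⇒pairwise-¬Proportional {ℓ = ℓ} {S} 2≤ℓ ℓ≤S kl = AllPairs-fromPairSublists pair-indep
    where
    pair-indep : ∀ {u v} → u ∷ v ∷ [] ⊆ S → ¬ Proportional F u v
    pair-indep pair⊆S =
      let X , pair⊆X , X⊆S , |X|≡ℓ = ⊆-intermediate ℓ 2≤ℓ ℓ≤S pair⊆S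
      in LinIndep-pair⇒¬Proportional
           (LinIndep-⊆ pair⊆X (ContainsIndep-length⇒LinIndep (kl X X⊆S |X|≡ℓ) |X|≡ℓ))

  KLIndependent⇒KLProIndependent : ∀ {S} → 2 ≤ ℓ → ℓ ≤ length S →
                                   KLIndependent F n ℓ ℓ S → KLProIndependent F n ℓ ℓ S
  KLIndependent⇒KLProIndependent 2≤ℓ ℓ≤S ((nonzero , _) , kl) =
    (nonzero , KLProperty⇒pairwise-¬Proportional 2≤ℓ ℓ≤S kl) , kl

  KLProperty-short : ∀ {S : List (Vect F n)} → length S < k → KLProperty F k ℓ S
  KLProperty-short S<k X X⊆S refl = contradiction (≤-<-trans (length-mono-≤ X⊆S) S<k) (<-irrefl refl)

  unitVector : Fin n → Vect F n
  unitVector i j with i ≟ j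
  ... | yes _ = 1#
  ... | no  _ = 0#

  unitVector-diag : (i : Fin n) → unitVector i i ≈ 1#
  unitVector-diag i with i ≟ i
  ... | yes _   = ≈-refl
  ... | no  i≢i = contradiction refl i≢i

  unitVector-offDiag : {i j : Fin n} → ¬ i ≡ j → unitVector i j ≈ 0#
  unitVector-offDiag {i = i} {j} i≢j with i ≟ j
  ... | yes i≡j = contradiction i≡j i≢j
  ... | no  _   = ≈-refl

  unitVector-nonZero : (i : Fin n) → NonZeroV F (unitVector i)
  unitVector-nonZero i eᵢ≈0 = 1≉0 (≈-trans (≈-sym (unitVector-diag i)) (eᵢ≈0 i))

  unitVector-¬Proportional : {i j : Fin n} → ¬ i ≡ j → ¬ Proportional F (unitVector i) (unitVector j)
  unitVector-¬Proportional {i = i} {j} i≢j (a , _ , eᵢ≈aeⱼ) = 1≉0 (begin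
    1#                 ≈⟨ ≈-sym (unitVector-diag i) ⟩
    unitVector i i     ≈⟨ eᵢ≈aeⱼ i ⟩
    a · unitVector j i ≈⟨ *-cong ≈-refl (unitVector-offDiag (i≢j ∘ sym)) ⟩
    a · 0#             ≈⟨ zeroʳ a ⟩
    0#                 ∎)

  unitVectors-IsProjSet : ∀ {I : List (Fin n)} → AllPairs (λ i j → ¬ i ≡ j) I →
                          IsProjSet F (map unitVector I)
  unitVectors-IsProjSet {I = I} distinct =
    Allₚ.map⁺ (All.universal unitVector-nonZero I) ,
    AllPairsₚ.map⁺ (AllPairs.map unitVector-¬Proportional distinct)

  ∃-IsProjSet-length : ∀ m → m ≤ n → ∃[ S ] IsProjSet F S × length S ≡ m
  ∃-IsProjSet-length {n} m m≤n =
    map unitVector I , unitVectors-IsProjSet (AllPairsₚ.take⁺ m (allFin⁺ n)) , |I|≡m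
    where
    I = take m (allFin n)
    |I|≡m : length (map unitVector I) ≡ m
    |I|≡m = trans (length-map unitVector I)
              (trans (length-take m (allFin n))
                (trans (cong (m ⊓_) (length-tabulate {n = n} id)) (m≤n⇒m⊓n≡m m≤n)))

  ∃-short-KLProIndependent : ∀ {m} → m < k → m ≤ n →
                             ∃[ S ] KLProIndependent F n k ℓ S × length S ≡ m
  ∃-short-KLProIndependent {m = m} m<k m≤n =
    let S , proj , |S|≡m = ∃-IsProjSet-length m m≤n
    in S , (proj , KLProperty-short (subst (_< _) (sym |S|≡m) m<k)) , |S|≡m

  IsIndPro≤IsInd : ∀ {a b} → IsIndPro F n k ℓ a → IsInd F n k ℓ b → a ≤ b
  IsIndPro≤IsInd ((S , pro , refl) , _) (_ , maximal) =
    maximal S (KLProIndependent⇒KLIndependent pro)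

  IsInd≤IsIndPro : ∀ {a b} → 2 ≤ ℓ → ℓ ≤ n → IsInd F n ℓ ℓ b → IsIndPro F n ℓ ℓ a → b ≤ a
  IsInd≤IsIndPro {ℓ = ℓ} 2≤ℓ ℓ≤n ((S , indep , refl) , _) (_ , maximal) with ℓ ≤? length S
  ... | yes ℓ≤S = maximal S (KLIndependent⇒KLProIndependent 2≤ℓ ℓ≤S indep)
  ... | no  ℓ≰S =
    let S<ℓ = ≰⇒> ℓ≰S
        T , proT , |T|≡|S| = ∃-short-KLProIndependent S<ℓ (≤-trans (<⇒≤ S<ℓ) ℓ≤n)
    in subst (_≤ _) |T|≡|S| (maximal T proT)

proposition2p12 : (q : ℕ) (F : FiniteField q) →
    ((n k ℓ : ℕ) → 2 ≤ ℓ → ℓ ≤ k → k * (q ∸ 1) ≤ q ^ n ∸ 1 → ℓ ≤ n →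
      (a b : ℕ) → IsIndPro F n k ℓ a → IsInd F n k ℓ b → a ≤ b)
    ×
    ((n ℓ : ℕ) → 2 ≤ ℓ → ℓ ≤ n →
      (a b : ℕ) → IsIndPro F n ℓ ℓ a → IsInd F n ℓ ℓ b → a ≡ b)
proposition2p12 q F =
  (λ _ _ _ _ _ _ _ _ _ → IsIndPro≤IsInd F) ,
  (λ _ _ 2≤ℓ ℓ≤n _ _ pro ind → ≤-antisym (IsIndPro≤IsInd F pro ind) (IsInd≤IsIndPro F 2≤ℓ ℓ≤n ind pro))
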